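{- There exists a polynomial $p$ such that for every $k\in\mathbb{N}$ and every set $\mathcal{A}$ of $n$ atoms (constants, type variables and constructor names), the number of types in $\mathbb{T}_C$ of level at most $k$ built from atoms in $\mathcal{A}$, counted modulo the type equality $=$, is at most $\exp_{k+1}(p(n))$, and (modulo $=$) such types have size at most $\exp_k(p(n))$.
   Context: Types $\mathbb{T}_C$: $\tau::=a\mid\alpha\mid\omega\mid\tau_1\to\tau_2\mid\tau_1\cap\tau_2\mid c(\tau)$ ($a$ constants, $\alpha$ type variables, $c$ unary constructors). Subtyping: least preorder with $\sigma\le\omega$; $\omega\le\omega\to\omega$; $\sigma\cap\tau\le\sigma,\tau$; $\sigma\le\tau_1,\sigma\le\tau_2\Rightarrow\sigma\le\tau_1\cap\tau_2$; $(\sigma\to\tau_1)\cap(\sigma\to\tau_2)\le\sigma\to\tau_1\cap\tau_2$; $\sigma_2\le\sigma_1,\tau_1\le\tau_2\Rightarrow\sigma_1\to\tau_1\le\sigma_2\to\tau_2$; $\tau_1\le\tau_2\Rightarrow c(\tau_1)\le c(\tau_2)$; $c(\tau_1)\cap c(\tau_2)\le c(\tau_1\cap\tau_2)$; $\sigma=\tau$ means $\sigma\le\tau$ and $\tau\le\sigma$. Level: $0$ for $\omega,a,\alpha$; $\mathrm{level}(c(\tau))=1+\mathrm{level}(\tau)$; $\mathrm{level}(\sigma\to\tau)=1+\max(\mathrm{level}(\sigma),\mathrm{level}(\tau))$; $\mathrm{level}(\sigma\cap\tau)=\max(\mathrm{level}(\sigma),\mathrm{level}(\tau))$. Size of a type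 is the number of nodes of its syntax tree. $\exp_0(n)=n$, $\exp_{j+1}(n)=2^{\exp_j(n)}$. -}

module Defs where

open import Data.Nat using (ℕ; zero; suc; _+_; _*_; _^_; _⊔_)
open import Data.Fin using (Fin)
open import Data.List using (List; []; _∷_)

-- Types of T_C over an atom set consisting of
--   nc constants, nv type variables and ncon unary constructor names.
-- The atom set has n = nc + nv + ncon elements.
infixr 7 _⇒_
infixl 8 _∩_

data Ty (nc nv ncon : ℕ) : Set where
  const : Fin nc → Ty nc nv ncon
  tvar  : Fin nv → Ty nc nv ncon
  ω     : Ty nc nv ncon
  _⇒_   : Ty nc nv ncon → Ty nc nv ncon → Ty nc nv ncon
  _∩_   : Ty nc nv ncon → Ty nc nv ncon → Ty nc nv ncon
  con   : Fin ncon → Ty nc nv ncon → Ty nc nv ncon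

module _ {nc nv ncon : ℕ} where

  infix 4 _≤T_ _≃T_

  data _≤T_ : Ty nc nv ncon → Ty nc nv ncon → Set where
    ≤-refl  : ∀ {σ} → σ ≤T σ
    ≤-trans : ∀ {σ τ ρ} → σ ≤T τ → τ ≤T ρ → σ ≤T ρ
    ≤-ω     : ∀ {σ} → σ ≤T ω
    ω≤ω⇒ω   : ω ≤T (ω ⇒ ω)
    ∩-lbˡ   : ∀ {σ τ} → (σ ∩ τ) ≤T σ
    ∩-lbʳ   : ∀ {σ τ} → (σ ∩ τ) ≤T τ
    ∩-glb   : ∀ {σ τ₁ τ₂} → σ ≤T τ₁ → σ ≤T τ₂ → σ ≤T (τ₁ ∩ τ₂)
    ⇒-∩     : ∀ {σ τ₁ τ₂} → ((σ ⇒ τ₁) ∩ (σ ⇒ τ₂)) ≤T (σ ⇒ (τ₁ ∩ τ₂))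
    ⇒-mono  : ∀ {σ₁ σ₂ τ₁ τ₂} → σ₂ ≤T σ₁ → τ₁ ≤T τ₂ → (σ₁ ⇒ τ₁) ≤T (σ₂ ⇒ τ₂)
    con-mono : ∀ {c τ₁ τ₂} → τ₁ ≤T τ₂ → con c τ₁ ≤T con c τ₂
    con-∩   : ∀ {c τ₁ τ₂} → (con c τ₁ ∩ con c τ₂) ≤T con c (τ₁ ∩ τ₂)

  record _≃T_ (σ τ : Ty nc nv ncon) : Set where
    constructor both
    field
      fwd : σ ≤T τ
      bwd : τ ≤T σ

  level : Ty nc nv ncon → ℕ
  level (const _) = 0
  level (tvar _)  = 0
  level ω         = 0
  level (σ ⇒ τ)   = suc (level σ ⊔ level τ)
  level (σ ∩ τ)   = level σ ⊔ level τ
  level (con _ τ) = suc (level τ)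

  size : Ty nc nv ncon → ℕ
  size (const _) = 1
  size (tvar _)  = 1
  size ω         = 1
  size (σ ⇒ τ)   = suc (size σ + size τ)
  size (σ ∩ τ)   = suc (size σ + size τ)
  size (con _ τ) = suc (size τ)

expT : ℕ → ℕ → ℕ
expT zero    n = n
expT (suc j) n = 2 ^ expT j n

Poly : Set
Poly = List ℕ

eval : Poly → ℕ → ℕ
eval []       x = 0
eval (a ∷ as) x = a + x * eval as x

-- Every type of level ≤ j is equal to an intersection of components of level j: atoms, c(N)
-- and N → C, where N is an intersection of components of level j − 1 and C is a component of
-- level j − 1. This uses c(σ) ∩ c(τ) = c(σ ∩ τ), (σ → τ₁) ∩ (σ → τ₂) = σ → τ₁ ∩ τ₂ and
-- σ → ω = ω (the empty intersection). As ∩ is associative, commutative and idempotent up to =,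
-- it suffices to intersect sublists of a fixed list of components, so with Cⱼ components of
-- level j there are at most 2^Cⱼ classes, and C_{j+1} ≤ n + (n + Cⱼ)·2^Cⱼ. A weight wⱼ
-- dominating Cⱼ and the sizes of components satisfies w_{j+1} ≤ 2^(2wⱼ + 4), hence
-- w_{j+1}² ≤ 2^(wⱼ²) once wⱼ ≥ 6; so wⱼ² is bounded by a tower of height j over w₀², a
-- quadratic polynomial in n, and it also bounds the sizes of the normal forms.
module Submission where

open import Defs
open import Data.Nat using (ℕ; zero; suc; _+_; _*_; _^_; _≤_; _<_; z≤n; s≤s)
import Data.Nat.Properties as ℕₚ
open import Data.Nat.Tactic.RingSolver using (solve-∀)
open import Data.List using (List; []; _∷_; length; map; _++_; cartesianProductWith; allFin)
open import Data.List.Properties using (length-map; length-++; length-tabulate)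
open import Data.List.Membership.Propositional using (_∈_)
open import Data.List.Membership.Propositional.Properties
  using (∈-map⁺; ∈-map⁻; ∈-++⁺ˡ; ∈-++⁺ʳ; ∈-++⁻; ∈-allFin; ∈-cartesianProductWith⁺; ∈-cartesianProductWith⁻)
open import Data.List.Relation.Unary.Any using (here; there)
open import Data.List.Relation.Binary.Subset.Propositional using (_⊆_)
open import Data.List.Relation.Binary.Subset.Propositional.Properties using (∈-∷⁺ʳ)
open import Data.List.Relation.Binary.Sublist.Propositional
  using ([]; _∷_; _∷ʳ_; minimum; lookup) renaming (_⊆_ to _⊑_)
open import Data.List.Relation.Binary.Sublist.Propositional.Properties using (length-mono-≤)
open import Data.Product using (Σ; _×_; ∃-syntax; _,_)
open import Data.Sum using (inj₁; inj₂; [_,_])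
open import Function using (_∘_)
open import Relation.Binary.PropositionalEquality using (_≡_; refl; sym; trans; cong; cong₂; module ≡-Reasoning)

sublists : {A : Set} → List A → List (List A)
sublists []       = [] ∷ []
sublists (x ∷ xs) = map (x ∷_) (sublists xs) ++ sublists xs

module _ {A : Set} where

  length-sublists : (xs : List A) → length (sublists xs) ≡ 2 ^ length xs
  length-sublists []       = refl
  length-sublists (x ∷ xs) = begin
    length (map (x ∷_) (sublists xs) ++ sublists xs)
      ≡⟨ length-++ (map (x ∷_) (sublists xs)) ⟩
    length (map (x ∷_) (sublists xs)) + length (sublists xs)
      ≡⟨ cong (_+ length (sublists xs)) (length-map (x ∷_) (sublists xs)) ⟩
    length (sublists xs) + length (sublists xs)
      ≡⟨ cong (λ k → k + k) (length-sublists xs) ⟩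
    2 ^ length xs + 2 ^ length xs
      ≡⟨ cong (2 ^ length xs +_) (sym (ℕₚ.+-identityʳ (2 ^ length xs))) ⟩
    2 ^ length (x ∷ xs) ∎
    where open ≡-Reasoning

  ⊑⇒∈sublists : {zs xs : List A} → zs ⊑ xs → zs ∈ sublists xs
  ⊑⇒∈sublists []                   = here refl
  ⊑⇒∈sublists {xs = _ ∷ xs} (y ∷ʳ p) = ∈-++⁺ʳ (map (y ∷_) (sublists xs)) (⊑⇒∈sublists p)
  ⊑⇒∈sublists (refl ∷ p)           = ∈-++⁺ˡ (∈-map⁺ (_ ∷_) (⊑⇒∈sublists p))

  ∈sublists⇒⊑ : {zs : List A} (xs : List A) → zs ∈ sublists xs → zs ⊑ xs
  ∈sublists⇒⊑ []       (here refl) = []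
  ∈sublists⇒⊑ (x ∷ xs) p with ∈-++⁻ (map (x ∷_) (sublists xs)) p
  ... | inj₂ q = x ∷ʳ ∈sublists⇒⊑ xs q
  ... | inj₁ q with _ , r , refl ← ∈-map⁻ (x ∷_) q = refl ∷ ∈sublists⇒⊑ xs r

length-allFin : ∀ k → length (allFin k) ≡ k
length-allFin k = length-tabulate (λ i → i)

length-cartesianProductWith : {A B C : Set} (f : A → B → C) (xs : List A) (ys : List B) →
  length (cartesianProductWith f xs ys) ≡ length xs * length ys
length-cartesianProductWith f []       ys = refl
length-cartesianProductWith f (x ∷ xs) ys =
  trans (length-++ (map (f x) ys))
        (cong₂ _+_ (length-map (f x) ys) (length-cartesianProductWith f xs ys))

n<2^n : ∀ n → n < 2 ^ n
n<2^n zero    = s≤s z≤n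
n<2^n (suc n) = ℕₚ.≤-trans (ℕₚ.+-mono-≤ (ℕₚ.m^n>0 2 n) (n<2^n n))
                           (ℕₚ.≤-reflexive (cong (2 ^ n +_) (sym (ℕₚ.+-identityʳ (2 ^ n)))))

1+c*[1+s]≤x*x : ∀ {c s x} → c < x → s < x → suc (c * suc s) ≤ x * x
1+c*[1+s]≤x*x {c} {s} {x} c<x s<x = begin
  suc (c * suc s) ≤⟨ s≤s (ℕₚ.*-monoʳ-≤ c s<x) ⟩
  suc (c * x)     ≤⟨ ℕₚ.+-monoˡ-≤ (c * x) (ℕₚ.≤-trans (s≤s z≤n) s<x) ⟩
  suc c * x       ≤⟨ ℕₚ.*-monoˡ-≤ x c<x ⟩
  x * x           ∎
  where open ℕₚ.≤-Reasoning

square≤2^square : ∀ {x y} → 6 ≤ x → y ≤ 16 * (2 ^ x * 2 ^ x) → y * y ≤ 2 ^ (x * x)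
square≤2^square {x} {y} 6≤x y≤ = begin
  y * y                                   ≤⟨ ℕₚ.*-mono-≤ y≤ y≤ ⟩
  16 * (2 ^ x * 2 ^ x) * (16 * (2 ^ x * 2 ^ x)) ≡⟨ fourth-power (2 ^ x) ⟩
  256 * (2 ^ x) ^ 4                       ≡⟨ cong (256 *_) (ℕₚ.^-*-assoc 2 x 4) ⟩
  256 * 2 ^ (x * 4)                       ≡⟨ sym (ℕₚ.^-distribˡ-+-* 2 8 (x * 4)) ⟩
  2 ^ (8 + x * 4)                         ≤⟨ ℕₚ.^-monoʳ-≤ 2 8+x*4≤x*x ⟩
  2 ^ (x * x)                             ∎
  where
  open ℕₚ.≤-Reasoning
  fourth-power : ∀ z → 16 * (z * z) * (16 * (z * z)) ≡ 256 * (z * (z * (z * (z * 1))))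
  fourth-power = solve-∀
  8+x*4≤x*x : 8 + x * 4 ≤ x * x
  8+x*4≤x*x = begin
    8 + x * 4     ≤⟨ ℕₚ.+-monoˡ-≤ (x * 4) (ℕₚ.≤-trans (ℕₚ.≤ᵇ⇒≤ 8 12 _) (ℕₚ.*-monoˡ-≤ 2 6≤x)) ⟩
    x * 2 + x * 4 ≡⟨ sym (ℕₚ.*-distribˡ-+ x 2 4) ⟩
    x * 6         ≤⟨ ℕₚ.*-monoʳ-≤ x 6≤x ⟩
    x * x         ∎

-- eval bound-polynomial n = (2n + 7)², the square of a bound on the initial weight below.
bound-polynomial : Poly
bound-polynomial = 49 ∷ 28 ∷ 4 ∷ []

module Growth (a m : ℕ) where

  n : ℕ
  n = a + m

  #components : ℕ → ℕ
  #components zero    = a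
  #components (suc j) = a + (m * 2 ^ #components j + 2 ^ #components j * #components j)

  componentSize normalFormSize : ℕ → ℕ
  normalFormSize j     = suc (#components j * suc (componentSize j))
  componentSize zero    = 1
  componentSize (suc j) = suc (normalFormSize j + componentSize j)

  weight : ℕ → ℕ
  weight j = 6 + (#components j + componentSize j + n)

  #components<weight : ∀ j → #components j < weight j
  #components<weight j =
    ℕₚ.m≤n⇒m≤o+n 5 (s≤s (ℕₚ.m≤n⇒m≤n+o n (ℕₚ.m≤m+n (#components j) (componentSize j))))

  componentSize<weight : ∀ j → componentSize j < weight j
  componentSize<weight j =
    ℕₚ.m≤n⇒m≤o+n 5 (s≤s (ℕₚ.m≤n⇒m≤n+o n (ℕₚ.m≤n+m (componentSize j) (#components j))))

  n<weight : ∀ j → n < weight j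
  n<weight j = ℕₚ.m≤n⇒m≤o+n 5 (s≤s (ℕₚ.m≤n+m n (#components j + componentSize j)))

  weight-suc : ∀ j → weight (suc j) ≤ 16 * (2 ^ weight j * 2 ^ weight j)
  weight-suc j = begin
    weight (suc j)
      ≡⟨ expand a m C M (2 ^ C) ⟩
    8 * 1 + a + m * 2 ^ C + 2 ^ C * C + C * M + C + M + n
      ≤⟨ ℕₚ.+-mono-≤ (ℕₚ.+-mono-≤ (ℕₚ.+-mono-≤ (ℕₚ.+-mono-≤ (ℕₚ.+-mono-≤ (ℕₚ.+-mono-≤ (ℕₚ.+-mono-≤
           (ℕₚ.*-monoʳ-≤ 8 1≤Z) (≤Z a≤X)) (ℕₚ.*-mono-≤ m≤Y 2^C≤Y)) (ℕₚ.*-mono-≤ 2^C≤Y C≤Y))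
           (ℕₚ.*-mono-≤ C≤Y M≤Y)) (≤Z C≤X)) (≤Z M≤X)) (≤Z n≤X) ⟩
    8 * Z + Z + Z + Z + Z + Z + Z + Z
      ≡⟨ collect Z ⟩
    15 * Z
      ≤⟨ ℕₚ.m≤n+m (15 * Z) Z ⟩
    16 * Z ∎
    where
    open ℕₚ.≤-Reasoning
    C M X Y Z : ℕ
    C = #components j
    M = componentSize j
    X = weight j
    Y = 2 ^ X
    Z = Y * Y
    expand : ∀ a m C M P →
      6 + ((a + (m * P + P * C)) + suc (suc (C * suc M) + M) + (a + m))
        ≡ 8 * 1 + a + m * P + P * C + C * M + C + M + (a + m)
    expand = solve-∀
    collect : ∀ Z → 8 * Z + Z + Z + Z + Z + Z + Z + Z ≡ 15 * Z
    collect = solve-∀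
    X≤Y : X ≤ Y
    X≤Y = ℕₚ.<⇒≤ (n<2^n X)
    Y≤Z : Y ≤ Z
    Y≤Z = ℕₚ.m≤m*n Y Y {{ℕₚ.m^n≢0 2 X}}
    1≤Z : 1 ≤ Z
    1≤Z = ℕₚ.≤-trans (ℕₚ.m^n>0 2 X) Y≤Z
    ≤Z : ∀ {x} → x ≤ X → x ≤ Z
    ≤Z x≤X = ℕₚ.≤-trans x≤X (ℕₚ.≤-trans X≤Y Y≤Z)
    C≤X : C ≤ X
    C≤X = ℕₚ.<⇒≤ (#components<weight j)
    M≤X : M ≤ X
    M≤X = ℕₚ.<⇒≤ (componentSize<weight j)
    n≤X : n ≤ X
    n≤X = ℕₚ.<⇒≤ (n<weight j)
    a≤X : a ≤ X
    a≤X = ℕₚ.≤-trans (ℕₚ.m≤m+n a m) n≤X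
    m≤Y : m ≤ Y
    m≤Y = ℕₚ.≤-trans (ℕₚ.m≤n+m m a) (ℕₚ.≤-trans n≤X X≤Y)
    C≤Y : C ≤ Y
    C≤Y = ℕₚ.≤-trans C≤X X≤Y
    M≤Y : M ≤ Y
    M≤Y = ℕₚ.≤-trans M≤X X≤Y
    2^C≤Y : 2 ^ C ≤ Y
    2^C≤Y = ℕₚ.^-monoʳ-≤ 2 C≤X

  weight-zero : weight 0 * weight 0 ≤ eval bound-polynomial n
  weight-zero = ℕₚ.≤-trans (ℕₚ.*-mono-≤ w≤ w≤) (ℕₚ.≤-reflexive (square n))
    where
    w≤ : weight 0 ≤ 6 + (n + 1 + n)
    w≤ = ℕₚ.+-monoʳ-≤ 6 (ℕₚ.+-monoˡ-≤ n (ℕₚ.+-monoˡ-≤ 1 (ℕₚ.m≤m+n a m)))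
    square : ∀ n → (6 + (n + 1 + n)) * (6 + (n + 1 + n)) ≡ 49 + n * (28 + n * (4 + n * 0))
    square = solve-∀

  weight²≤tower : ∀ j → weight j * weight j ≤ expT j (eval bound-polynomial n)
  weight²≤tower zero    = weight-zero
  weight²≤tower (suc j) = ℕₚ.≤-trans (square≤2^square {weight j} (ℕₚ.m≤m+n 6 _) (weight-suc j))
                                     (ℕₚ.^-monoʳ-≤ 2 (weight²≤tower j))

  #components≤tower : ∀ j → #components j ≤ expT j (eval bound-polynomial n)
  #components≤tower j = ℕₚ.≤-trans (ℕₚ.<⇒≤ (#components<weight j))
                                   (ℕₚ.≤-trans (ℕₚ.m≤m*n (weight j) (weight j)) (weight²≤tower j))

  normalFormSize≤tower : ∀ j → normalFormSize j ≤ expT j (eval bound-polynomial n)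
  normalFormSize≤tower j = ℕₚ.≤-trans (1+c*[1+s]≤x*x (#components<weight j) (componentSize<weight j))
                                      (weight²≤tower j)

module _ {nc nv ncon : ℕ} where

  private
    Type : Set
    Type = Ty nc nv ncon

  ≃-refl : {σ : Type} → σ ≃T σ
  ≃-refl = both ≤-refl ≤-refl

  ≃-sym : {σ τ : Type} → σ ≃T τ → τ ≃T σ
  ≃-sym (both f b) = both b f

  ≃-trans : {σ τ ρ : Type} → σ ≃T τ → τ ≃T ρ → σ ≃T ρ
  ≃-trans (both f b) (both f′ b′) = both (≤-trans f f′) (≤-trans b′ b)

  ∩-mono : {σ₁ σ₂ τ₁ τ₂ : Type} → σ₁ ≤T σ₂ → τ₁ ≤T τ₂ → σ₁ ∩ τ₁ ≤T σ₂ ∩ τ₂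
  ∩-mono p q = ∩-glb (≤-trans ∩-lbˡ p) (≤-trans ∩-lbʳ q)

  ∩-cong : {σ₁ σ₂ τ₁ τ₂ : Type} → σ₁ ≃T σ₂ → τ₁ ≃T τ₂ → σ₁ ∩ τ₁ ≃T σ₂ ∩ τ₂
  ∩-cong (both f b) (both f′ b′) = both (∩-mono f f′) (∩-mono b b′)

  ⇒-cong : {σ₁ σ₂ τ₁ τ₂ : Type} → σ₁ ≃T σ₂ → τ₁ ≃T τ₂ → σ₁ ⇒ τ₁ ≃T σ₂ ⇒ τ₂
  ⇒-cong (both f b) (both f′ b′) = both (⇒-mono b f′) (⇒-mono f b′)

  con-cong : ∀ {c} {σ τ : Type} → σ ≃T τ → con c σ ≃T con c τ
  con-cong (both f b) = both (con-mono f) (con-mono b)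

  ∩-idemˡ : {σ τ : Type} → σ ∩ (σ ∩ τ) ≃T σ ∩ τ
  ∩-idemˡ = both ∩-lbʳ (∩-glb ∩-lbˡ ≤-refl)

  ∩-leftComm : {σ τ ρ : Type} → σ ∩ (τ ∩ ρ) ≃T τ ∩ (σ ∩ ρ)
  ∩-leftComm = both swap swap
    where
    swap : {σ τ ρ : Type} → σ ∩ (τ ∩ ρ) ≤T τ ∩ (σ ∩ ρ)
    swap = ∩-glb (≤-trans ∩-lbʳ ∩-lbˡ) (∩-mono ≤-refl ∩-lbʳ)

  ⋂ : List Type → Type
  ⋂ []       = ω
  ⋂ (x ∷ xs) = x ∩ ⋂ xs

  ⋂-lb : {y : Type} {xs : List Type} → y ∈ xs → ⋂ xs ≤T y
  ⋂-lb (here refl) = ∩-lbˡ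
  ⋂-lb (there p)   = ≤-trans ∩-lbʳ (⋂-lb p)

  ⋂-glb : {σ : Type} (ys : List Type) → (∀ {y} → y ∈ ys → σ ≤T y) → σ ≤T ⋂ ys
  ⋂-glb []       h = ≤-ω
  ⋂-glb (y ∷ ys) h = ∩-glb (h (here refl)) (⋂-glb ys (h ∘ there))

  ⋂-antimono : {xs ys : List Type} → xs ⊆ ys → ⋂ ys ≤T ⋂ xs
  ⋂-antimono {xs} xs⊆ys = ⋂-glb xs (⋂-lb ∘ xs⊆ys)

  ⋂-singleton : {σ : Type} → σ ≃T ⋂ (σ ∷ [])
  ⋂-singleton = both (∩-glb ≤-refl ≤-ω) ∩-lbˡ

  ⋂-++ : (xs ys : List Type) → ⋂ (xs ++ ys) ≃T ⋂ xs ∩ ⋂ ys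
  ⋂-++ xs ys = both (∩-glb (⋂-antimono ∈-++⁺ˡ) (⋂-antimono (∈-++⁺ʳ xs)))
                    (⋂-glb (xs ++ ys) ([ ≤-trans ∩-lbˡ ∘ ⋂-lb , ≤-trans ∩-lbʳ ∘ ⋂-lb ] ∘ ∈-++⁻ xs))

  ⋂-map-⇒ : (σ : Type) (xs : List Type) → ⋂ (map (σ ⇒_) xs) ≃T σ ⇒ ⋂ xs
  ⋂-map-⇒ σ []       = both (≤-trans ω≤ω⇒ω (⇒-mono ≤-ω ≤-refl)) ≤-ω
  ⋂-map-⇒ σ (x ∷ xs) with both f b ← ⋂-map-⇒ σ xs =
    both (≤-trans (∩-mono ≤-refl f) ⇒-∩)
         (∩-glb (⇒-mono ≤-refl ∩-lbˡ) (≤-trans (⇒-mono ≤-refl ∩-lbʳ) b))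

  -- Membership proofs locate x in L, so no decidable equality of types is needed.
  ⋂-insert : {x : Type} {zs L : List Type} → x ∈ L → zs ⊑ L → ∃[ zs′ ] zs′ ⊑ L × x ∩ ⋂ zs ≃T ⋂ zs′
  ⋂-insert (here refl) (y ∷ʳ p)   = _ , refl ∷ p , ≃-refl
  ⋂-insert (here refl) (refl ∷ p) = _ , refl ∷ p , ∩-idemˡ
  ⋂-insert (there x∈L) (y ∷ʳ p) with zs′ , q , e ← ⋂-insert x∈L p = zs′ , y ∷ʳ q , e
  ⋂-insert (there x∈L) (refl ∷ p) with zs′ , q , e ← ⋂-insert x∈L p =
    _ ∷ zs′ , refl ∷ q , ≃-trans ∩-leftComm (∩-cong ≃-refl e)

  ⋂-sublist : {L : List Type} (xs : List Type) → xs ⊆ L → ∃[ zs ] zs ⊑ L × ⋂ xs ≃T ⋂ zs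
  ⋂-sublist []       _     = [] , minimum _ , ≃-refl
  ⋂-sublist (x ∷ xs) xs⊆L
    with zs , p , e ← ⋂-sublist xs (xs⊆L ∘ there)
    with zs′ , q , e′ ← ⋂-insert (xs⊆L (here refl)) p
    = zs′ , q , ≃-trans (∩-cong ≃-refl e) e′

  atoms : List Type
  atoms = map const (allFin nc) ++ map tvar (allFin nv)

  components normalForms : ℕ → List Type
  normalForms j        = map ⋂ (sublists (components j))
  components zero    = atoms
  components (suc j) = atoms ++ (cartesianProductWith con (allFin ncon) (normalForms j)
                                  ++ cartesianProductWith _⇒_ (normalForms j) (components j))

  atom∈components : ∀ j {y} → y ∈ atoms → y ∈ components j
  atom∈components zero    p = p
  atom∈components (suc j) p = ∈-++⁺ˡ p

  con∈components : ∀ j {c N} → N ∈ normalForms j → con c N ∈ components (suc j)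
  con∈components j {c} p =
    ∈-++⁺ʳ atoms (∈-++⁺ˡ (∈-cartesianProductWith⁺ con (∈-allFin c) p))

  ⇒∈components : ∀ j {N C} → N ∈ normalForms j → C ∈ components j → N ⇒ C ∈ components (suc j)
  ⇒∈components j p q =
    ∈-++⁺ʳ atoms (∈-++⁺ʳ (cartesianProductWith con (allFin ncon) (normalForms j))
                         (∈-cartesianProductWith⁺ _⇒_ p q))

  ⋂∈normalForms : ∀ j {zs} → zs ⊑ components j → ⋂ zs ∈ normalForms j
  ⋂∈normalForms j p = ∈-map⁺ ⋂ (⊑⇒∈sublists p)

  mutual
    normalise : ∀ j (τ : Type) → level τ ≤ j → ∃[ xs ] xs ⊆ components j × τ ≃T ⋂ xs
    normalise j (const i) _ =
      const i ∷ [] , ∈-∷⁺ʳ (atom∈components j (∈-++⁺ˡ (∈-map⁺ const (∈-allFin i)))) (λ ()) , ⋂-singleton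
    normalise j (tvar i)  _ =
      tvar i ∷ [] , ∈-∷⁺ʳ (atom∈components j (∈-++⁺ʳ _ (∈-map⁺ tvar (∈-allFin i)))) (λ ()) , ⋂-singleton
    normalise j ω         _ = [] , (λ ()) , ≃-refl
    normalise j (σ ∩ τ)   l
      with xs , xs⊆ , eσ ← normalise j σ (ℕₚ.m⊔n≤o⇒m≤o (level σ) (level τ) l)
         | ys , ys⊆ , eτ ← normalise j τ (ℕₚ.m⊔n≤o⇒n≤o (level σ) (level τ) l)
      = xs ++ ys , [ xs⊆ , ys⊆ ] ∘ ∈-++⁻ xs , ≃-trans (∩-cong eσ eτ) (≃-sym (⋂-++ xs ys))
    normalise (suc j) (con c τ) (s≤s l) with N , N∈ , e ← normalForm j τ l =
      con c N ∷ [] , ∈-∷⁺ʳ (con∈components j N∈) (λ ()) , ≃-trans (con-cong e) ⋂-singleton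
    normalise (suc j) (σ ⇒ τ) (s≤s l)
      with N , N∈ , eσ ← normalForm j σ (ℕₚ.m⊔n≤o⇒m≤o (level σ) (level τ) l)
         | xs , xs⊆ , eτ ← normalise j τ (ℕₚ.m⊔n≤o⇒n≤o (level σ) (level τ) l)
      = map (N ⇒_) xs , arrows⊆ , ≃-trans (⇒-cong eσ eτ) (≃-sym (⋂-map-⇒ N xs))
      where
      arrows⊆ : map (N ⇒_) xs ⊆ components (suc j)
      arrows⊆ p with _ , q , refl ← ∈-map⁻ (N ⇒_) p = ⇒∈components j N∈ (xs⊆ q)

    normalForm : ∀ j (τ : Type) → level τ ≤ j → ∃[ σ ] σ ∈ normalForms j × τ ≃T σ
    normalForm j τ l
      with xs , xs⊆ , e ← normalise j τ l
      with zs , zs⊑ , e′ ← ⋂-sublist xs xs⊆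
      = ⋂ zs , ⋂∈normalForms j zs⊑ , ≃-trans e e′

  open Growth (nc + nv) ncon

  length-atoms : length atoms ≡ nc + nv
  length-atoms = trans (length-++ (map const (allFin nc)))
    (cong₂ _+_ (trans (length-map const (allFin nc)) (length-allFin nc))
               (trans (length-map tvar (allFin nv)) (length-allFin nv)))

  length-normalForms : ∀ j → length (normalForms j) ≡ 2 ^ length (components j)
  length-normalForms j = trans (length-map ⋂ (sublists (components j))) (length-sublists (components j))

  length-components : ∀ j → length (components j) ≡ #components j
  length-components zero    = length-atoms
  length-components (suc j) = begin
    length (atoms ++ (cartesianProductWith con (allFin ncon) N ++ cartesianProductWith _⇒_ N C))
      ≡⟨ length-++ atoms ⟩
    length atoms + length (cartesianProductWith con (allFin ncon) N ++ cartesianProductWith _⇒_ N C)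
      ≡⟨ cong (length atoms +_) (length-++ (cartesianProductWith con (allFin ncon) N)) ⟩
    length atoms + (length (cartesianProductWith con (allFin ncon) N) + length (cartesianProductWith _⇒_ N C))
      ≡⟨ cong₂ _+_ length-atoms (cong₂ _+_ (length-cartesianProductWith con (allFin ncon) N)
                                           (length-cartesianProductWith _⇒_ N C)) ⟩
    nc + nv + (length (allFin ncon) * length N + length N * length C)
      ≡⟨ cong₂ (λ k l → nc + nv + (k * l + l * length C)) (length-allFin ncon) #N ⟩
    nc + nv + (ncon * 2 ^ #components j + 2 ^ #components j * length C)
      ≡⟨ cong (λ k → nc + nv + (ncon * 2 ^ #components j + 2 ^ #components j * k)) (length-components j) ⟩
    #components (suc j) ∎
    where
    open ≡-Reasoning
    N = normalForms j
    C = components j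
    #N : length N ≡ 2 ^ #components j
    #N = trans (length-normalForms j) (cong (2 ^_) (length-components j))

  size-⋂ : ∀ {M} (zs : List Type) → (∀ {y} → y ∈ zs → size y ≤ M) → size (⋂ zs) ≤ suc (length zs * suc M)
  size-⋂     []       h = s≤s z≤n
  size-⋂ {M} (z ∷ zs) h = s≤s (ℕₚ.≤-trans (ℕₚ.+-mono-≤ (h (here refl)) (size-⋂ zs (h ∘ there)))
                                          (ℕₚ.≤-reflexive (ℕₚ.+-suc M _)))

  size-atom : ∀ {y} → y ∈ atoms → size y ≤ 1
  size-atom p with ∈-++⁻ (map const (allFin nc)) p
  ... | inj₁ q with _ , _ , refl ← ∈-map⁻ const q = ℕₚ.≤-refl
  ... | inj₂ q with _ , _ , refl ← ∈-map⁻ tvar q  = ℕₚ.≤-refl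

  mutual
    size-components : ∀ j {y} → y ∈ components j → size y ≤ componentSize j
    size-components zero    p = size-atom p
    size-components (suc j) p with ∈-++⁻ atoms p
    ... | inj₁ q = ℕₚ.≤-trans (size-atom q) (s≤s z≤n)
    ... | inj₂ q with ∈-++⁻ (cartesianProductWith con (allFin ncon) (normalForms j)) q
    ... | inj₁ r with _ , _ , _ , N∈ , refl ← ∈-cartesianProductWith⁻ con (allFin ncon) (normalForms j) r =
      s≤s (ℕₚ.m≤n⇒m≤n+o (componentSize j) (size-normalForms j N∈))
    ... | inj₂ r with _ , _ , N∈ , C∈ , refl ← ∈-cartesianProductWith⁻ _⇒_ (normalForms j) (components j) r =
      s≤s (ℕₚ.+-mono-≤ (size-normalForms j N∈) (size-components j C∈))

    size-normalForms : ∀ j {σ} → σ ∈ normalForms j → size σ ≤ normalFormSize j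
    size-normalForms j p with zs , zs∈ , refl ← ∈-map⁻ ⋂ p =
      ℕₚ.≤-trans (size-⋂ zs (size-components j ∘ lookup zs⊑))
                 (s≤s (ℕₚ.*-monoˡ-≤ (suc (componentSize j))
                        (ℕₚ.≤-trans (length-mono-≤ zs⊑) (ℕₚ.≤-reflexive (length-components j)))))
      where
      zs⊑ : zs ⊑ components j
      zs⊑ = ∈sublists⇒⊑ (components j) zs∈

  length-normalForms≤tower : ∀ k → length (normalForms k) ≤ expT (suc k) (eval bound-polynomial n)
  length-normalForms≤tower k = ℕₚ.≤-trans (ℕₚ.≤-reflexive (length-normalForms k))
    (ℕₚ.^-monoʳ-≤ 2 (ℕₚ.≤-trans (ℕₚ.≤-reflexive (length-components k)) (#components≤tower k)))

  small-representative : ∀ k (τ : Type) → level τ ≤ k → ∃[ σ ] τ ≃T σ × size σ ≤ expT k (eval bound-polynomial n)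
  small-representative k τ l with σ , σ∈ , e ← normalForm k τ l =
    σ , e , ℕₚ.≤-trans (size-normalForms k σ∈) (normalFormSize≤tower k)

lemma4p12 : Σ Poly λ p → (k nc nv ncon : ℕ) →
    (Σ (List (Ty nc nv ncon)) λ reps →
        (length reps ≤ expT (suc k) (eval p (nc + nv + ncon)))
        × ((τ : Ty nc nv ncon) → level τ ≤ k → ∃[ σ ] (σ ∈ reps × τ ≃T σ)))
    × ((τ : Ty nc nv ncon) → level τ ≤ k →
        ∃[ σ ] (τ ≃T σ × size σ ≤ expT k (eval p (nc + nv + ncon))))
lemma4p12 = bound-polynomial , λ k nc nv ncon →
  (normalForms k , length-normalForms≤tower k , normalForm k) , small-representative k
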